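{- Let $$B=\begin{pmatrix}0&-p_3'&p_2\\ p_3&0&-p_1'\\ -p_2'&p_1&0\end{pmatrix}$$ be a $3\times3$ skew-symmetrizable integer matrix with $p_i,p_i'>0$ for $i=1,2,3$ (so $B$ is cyclic with $p_3>0$) and $p_ip_i'\ge 4$ for $i=1,2,3$ (totally-infinite type). Put $A=p_1p_2p_3=p_1'p_2'p_3'$. Then: (1) at least one of the vertices $v_1,v_2,v_3$ is of Type 4-1; (2) if $v_2$ is the only one among $v_1,v_2,v_3$ that is of Type 4-1, then $v_1$ is of Type 4-2 and $v_3$ is of Type 4-3.
   Context: For such $B$ (skew-symmetrizability means there are positive $d_1,d_2,d_3$ with $d_3p_1=d_2p_1'$, $d_1p_2=d_3p_2'$, $d_2p_3=d_1p_3'$; in particular $p_1p_2p_3=p_1'p_2'p_3'$), the types of the elementary vertices $v_1,v_2,v_3$ (representing the rays $\mathbb{R}_{\ge0}\mathbf e_i$) are defined as follows, with $A=p_1p_2p_3$. Vertex $v_3$: Type 4-1 if $p_1p_1'+p_2p_2'\le A$; Type 4-2 if $p_1p_1'+p_2p_2'>A$ and $2p_1p_1'>A$; Type 4-3 if $p_1p_1'+p_2p_2'>A$ and $2p_1p_1'<A$. Vertex $v_1$: Type 4-1 if $p_2p_2'+p_3p_3'\le A$; Type 4-2 if $p_2p_2'+p_3p_3'>A$ and $2p_2p_2'>A$; Type 4-3 if $p_2p_2'+p_3p_3'>A$ and $2p_2p_2'<A$. Vertex $v_2$: Type 4-1 if $p_3p_3'+p_1p_1'\le A$; Type 4-2 if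 $p_3p_3'+p_1p_1'>A$ and $2p_3p_3'>A$; Type 4-3 if $p_3p_3'+p_1p_1'>A$ and $2p_3p_3'<A$. -}

module Defs where

open import Data.Nat using (ℕ; _+_; _*_; _≤_; _<_; _>_)
open import Data.Product using (_×_; Σ; ∃-syntax)
open import Relation.Nullary using (¬_)

-- The 3x3 cyclic matrix B is encoded by its six entry magnitudes
-- p1 p2 p3 p1' p2' p3' (all positive).
record Params : Set where
  constructor params
  field
    p1 p2 p3 p1' p2' p3' : ℕ

open Params public

Aval : Params → ℕ
Aval P = p1 P * p2 P * p3 P

Positive : Params → Set
Positive P = (0 < p1 P) × (0 < p2 P) × (0 < p3 P)
           × (0 < p1' P) × (0 < p2' P) × (0 < p3' P)

SkewSymmetrizable : Params → Set
SkewSymmetrizable P = ∃[ d1 ] ∃[ d2 ] ∃[ d3 ]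
  ((0 < d1) × (0 < d2) × (0 < d3)
   × (d3 * p1 P ≡' d2 * p1' P)
   × (d1 * p2 P ≡' d3 * p2' P)
   × (d2 * p3 P ≡' d1 * p3' P))
  where
  open import Relation.Binary.PropositionalEquality renaming (_≡_ to _≡'_)

TotallyInfinite : Params → Set
TotallyInfinite P = (4 ≤ p1 P * p1' P) × (4 ≤ p2 P * p2' P) × (4 ≤ p3 P * p3' P)

data Vertex : Set where
  v1 v2 v3 : Vertex

firstProd : Params → Vertex → ℕ
firstProd P v1 = p2 P * p2' P
firstProd P v2 = p3 P * p3' P
firstProd P v3 = p1 P * p1' P

secondProd : Params → Vertex → ℕ
secondProd P v1 = p3 P * p3' P
secondProd P v2 = p1 P * p1' P
secondProd P v3 = p2 P * p2' P

Type4-1 : Params → Vertex → Set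
Type4-1 P v = firstProd P v + secondProd P v ≤ Aval P

Type4-2 : Params → Vertex → Set
Type4-2 P v = (firstProd P v + secondProd P v > Aval P) × (2 * firstProd P v > Aval P)

Type4-3 : Params → Vertex → Set
Type4-3 P v = (firstProd P v + secondProd P v > Aval P) × (2 * firstProd P v < Aval P)

{-# OPTIONS --safe #-}
-- Write x, y, z for p1 p1', p2 p2', p3 p3'. Skew-symmetrizability gives
-- A² = x y z. If c is the largest of the three products and a ≤ b are the
-- other two, then (a + b)² ≤ (2b)² ≤ a b c = A² because a ≥ 4, so a + b ≤ A:
-- the vertex whose two products avoid the largest one is of Type 4-1.
-- If only v2 is of Type 4-1, then z + x ≤ A < y + z forces x < y, whence
-- A < x + y < 2y and (2x)² = x · 4x < x · y z = A².
module Submission where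

open import Defs
open import Data.List using (_∷_; [])
open import Data.Nat
open import Data.Nat.Properties
open import Data.Nat.Tactic.RingSolver using (solve; solve-∀)
open import Data.Product using (_×_; _,_)
open import Data.Sum using (_⊎_; inj₁; inj₂)
open import Relation.Binary.PropositionalEquality
open import Relation.Nullary using (¬_)

m*m≤n*n⇒m≤n : ∀ {m n} → m * m ≤ n * n → m ≤ n
m*m≤n*n⇒m≤n m*m≤n*n = ≮⇒≥ λ n<m → <⇒≱ (*-mono-< n<m n<m) m*m≤n*n

m*m<n*n⇒m<n : ∀ {m n} → m * m < n * n → m < n
m*m<n*n⇒m<n m*m<n*n = ≰⇒> λ n≤m → <⇒≱ m*m<n*n (*-mono-≤ n≤m n≤m)

*-rotate : ∀ a b c → a * b * c ≡ b * c * a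
*-rotate = solve-∀

square-sum≤product : ∀ {a b c} → 4 ≤ a → a ≤ b → b ≤ c → (a + b) * (a + b) ≤ a * b * c
square-sum≤product {a} {b} {c} 4≤a a≤b b≤c = begin
  (a + b) * (a + b) ≤⟨ *-mono-≤ (+-monoˡ-≤ b a≤b) (+-monoˡ-≤ b a≤b) ⟩
  (b + b) * (b + b) ≡⟨ doubled-square b ⟩
  4 * b * b         ≤⟨ *-mono-≤ (*-monoˡ-≤ b 4≤a) b≤c ⟩
  a * b * c         ∎
  where
  open ≤-Reasoning
  doubled-square : ∀ b → (b + b) * (b + b) ≡ 4 * b * b
  doubled-square = solve-∀

sum-below-largest≤root : ∀ {A a b c} → A * A ≡ a * b * c →
  4 ≤ a → 4 ≤ b → a ≤ c → b ≤ c → a + b ≤ A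
sum-below-largest≤root {A} {a} {b} {c} sq 4≤a 4≤b a≤c b≤c =
  m*m≤n*n⇒m≤n (subst ((a + b) * (a + b) ≤_) (sym sq) (ordered (≤-total a b)))
  where
  ordered : a ≤ b ⊎ b ≤ a → (a + b) * (a + b) ≤ a * b * c
  ordered (inj₁ a≤b) = square-sum≤product 4≤a a≤b b≤c
  ordered (inj₂ b≤a) =
    subst₂ _≤_ (cong₂ _*_ (+-comm b a) (+-comm b a)) (cong (_* c) (*-comm b a))
      (square-sum≤product 4≤b b≤a a≤c)

some-pair-sum≤root : ∀ {A x y z} → A * A ≡ x * y * z → 4 ≤ x → 4 ≤ y → 4 ≤ z →
  y + z ≤ A ⊎ z + x ≤ A ⊎ x + y ≤ A
some-pair-sum≤root {A} {x} {y} {z} sq 4≤x 4≤y 4≤z = by-largest (≤-total x y)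
  where
  sq′ : A * A ≡ y * z * x
  sq′ = trans sq (*-rotate x y z)
  sq″ : A * A ≡ z * x * y
  sq″ = trans sq′ (*-rotate y z x)
  x-largest : y ≤ x → z ≤ x → y + z ≤ A ⊎ z + x ≤ A ⊎ x + y ≤ A
  x-largest y≤x z≤x = inj₁ (sum-below-largest≤root sq′ 4≤y 4≤z y≤x z≤x)
  y-largest : z ≤ y → x ≤ y → y + z ≤ A ⊎ z + x ≤ A ⊎ x + y ≤ A
  y-largest z≤y x≤y = inj₂ (inj₁ (sum-below-largest≤root sq″ 4≤z 4≤x z≤y x≤y))
  z-largest : x ≤ z → y ≤ z → y + z ≤ A ⊎ z + x ≤ A ⊎ x + y ≤ A
  z-largest x≤z y≤z = inj₂ (inj₂ (sum-below-largest≤root sq 4≤x 4≤y x≤z y≤z))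
  by-largest : x ≤ y ⊎ y ≤ x → y + z ≤ A ⊎ z + x ≤ A ⊎ x + y ≤ A
  by-largest (inj₁ x≤y) with ≤-total y z
  ... | inj₁ y≤z = z-largest (≤-trans x≤y y≤z) y≤z
  ... | inj₂ z≤y = y-largest z≤y x≤y
  by-largest (inj₂ y≤x) with ≤-total x z
  ... | inj₁ x≤z = z-largest x≤z (≤-trans y≤x x≤z)
  ... | inj₂ z≤x = x-largest y≤x z≤x

twice-smaller<root : ∀ {A x y z} → A * A ≡ x * y * z → 0 < x → x < y → 4 ≤ z → 2 * x < A
twice-smaller<root {A} {x} {y} {z} sq 0<x x<y 4≤z = m*m<n*n⇒m<n (begin-strict
  2 * x * (2 * x) ≡⟨ doubled-square x ⟩
  4 * x * x       <⟨ *-monoˡ-< x {{>-nonZero 0<x}} 4x<yz ⟩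
  y * z * x       ≡⟨ *-rotate y z x ⟩
  z * x * y       ≡⟨ *-rotate z x y ⟩
  x * y * z       ≡⟨ sym sq ⟩
  A * A           ∎)
  where
  open ≤-Reasoning
  doubled-square : ∀ x → 2 * x * (2 * x) ≡ 4 * x * x
  doubled-square = solve-∀
  4x<yz : 4 * x < y * z
  4x<yz = begin-strict
    4 * x <⟨ *-monoʳ-< 4 x<y ⟩
    4 * y ≤⟨ *-monoˡ-≤ y 4≤z ⟩
    z * y ≡⟨ *-comm z y ⟩
    y * z ∎

only-middle-sum≤root : ∀ {A x y z} → A * A ≡ x * y * z → 0 < x → 4 ≤ z →
  z + x ≤ A → A < y + z → A < x + y → A < 2 * y × 2 * x < A
only-middle-sum≤root {A} {x} {y} {z} sq 0<x 4≤z z+x≤A A<y+z A<x+y =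
  A<2y , twice-smaller<root sq 0<x x<y 4≤z
  where
  open ≤-Reasoning
  x<y : x < y
  x<y = +-cancelˡ-< z x y (begin-strict
    z + x ≤⟨ z+x≤A ⟩
    A     <⟨ A<y+z ⟩
    y + z ≡⟨ +-comm y z ⟩
    z + y ∎)
  A<2y : A < 2 * y
  A<2y = begin-strict
    A     <⟨ A<x+y ⟩
    x + y ≤⟨ +-monoˡ-≤ y (<⇒≤ x<y) ⟩
    y + y ≡⟨ cong (y +_) (sym (+-identityʳ y)) ⟩
    2 * y ∎

skewSymmetrizable⇒p1p2p3≡p1'p2'p3' : ∀ P → SkewSymmetrizable P →
  p1 P * p2 P * p3 P ≡ p1' P * p2' P * p3' P
skewSymmetrizable⇒p1p2p3≡p1'p2'p3'
  (params p1 p2 p3 p1' p2' p3') (d1 , d2 , d3 , 0<d1 , 0<d2 , 0<d3 , e1 , e2 , e3) =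
  *-cancelˡ-≡ _ _ (d1 * d2 * d3) {{>-nonZero (*-mono-< (*-mono-< 0<d1 0<d2) 0<d3)}} (begin
    d1 * d2 * d3 * (p1 * p2 * p3)        ≡⟨ solve (d1 ∷ d2 ∷ d3 ∷ p1 ∷ p2 ∷ p3 ∷ []) ⟩
    (d3 * p1) * (d1 * p2) * (d2 * p3)    ≡⟨ cong₂ _*_ (cong₂ _*_ e1 e2) e3 ⟩
    (d2 * p1') * (d3 * p2') * (d1 * p3') ≡⟨ solve (d1 ∷ d2 ∷ d3 ∷ p1' ∷ p2' ∷ p3' ∷ []) ⟩
    d1 * d2 * d3 * (p1' * p2' * p3')     ∎)
  where open ≡-Reasoning

Aval²≡product : ∀ P → SkewSymmetrizable P →
  Aval P * Aval P ≡ p1 P * p1' P * (p2 P * p2' P) * (p3 P * p3' P)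
Aval²≡product P@(params p1 p2 p3 p1' p2' p3') skew = begin
  (p1 * p2 * p3) * (p1 * p2 * p3)      ≡⟨ cong ((p1 * p2 * p3) *_) (skewSymmetrizable⇒p1p2p3≡p1'p2'p3' P skew) ⟩
  (p1 * p2 * p3) * (p1' * p2' * p3')   ≡⟨ solve (p1 ∷ p2 ∷ p3 ∷ p1' ∷ p2' ∷ p3' ∷ []) ⟩
  p1 * p1' * (p2 * p2') * (p3 * p3')   ∎
  where open ≡-Reasoning

lemma6p4 : (P : Params) → Positive P → SkewSymmetrizable P → TotallyInfinite P →
    ((Type4-1 P v1 ⊎ Type4-1 P v2 ⊎ Type4-1 P v3)
     × (Type4-1 P v2 → ¬ Type4-1 P v1 → ¬ Type4-1 P v3 → Type4-2 P v1 × Type4-3 P v3))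
lemma6p4 P@(params p1 p2 p3 p1' p2' p3') (0<p1 , _ , _ , 0<p1' , _ , _) skew (4≤x , 4≤y , 4≤z) =
  some-pair-sum≤root sq 4≤x 4≤y 4≤z , only-v2
  where
  sq : Aval P * Aval P ≡ p1 * p1' * (p2 * p2') * (p3 * p3')
  sq = Aval²≡product P skew
  only-v2 : Type4-1 P v2 → ¬ Type4-1 P v1 → ¬ Type4-1 P v3 → Type4-2 P v1 × Type4-3 P v3
  only-v2 z+x≤A y+z≰A x+y≰A =
    let A<y+z = ≰⇒> y+z≰A
        A<x+y = ≰⇒> x+y≰A
        A<2y , 2x<A = only-middle-sum≤root sq (*-mono-< 0<p1 0<p1') 4≤z z+x≤A A<y+z A<x+y
    in (A<y+z , A<2y) , (A<x+y , 2x<A)
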